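{- Fix $i \in \{1,\dots,k\}$, and let $\mathcal{S}$ be a valid collection of linearly independent difference equalities in $x_1,\dots,x_k$ that all involve $x_i$. Then $\mathcal{S}$ $i$-certifies at most $2|\mathcal{S}|$ indices.
   Context: A difference equality in $x_1,\dots,x_k$ is a linear equation over $\mathbb{R}$ of the form $x_{i_1} - x_{i_2} - x_{i_3} + x_{i_4} = 0$ with $i_1,\dots,i_4 \in \{1,\dots,k\}$ not necessarily distinct and $\{i_1,i_4\} \neq \{i_2,i_3\}$; equations are identified up to rearrangement (including multiplying by $-1$). The content of an equation $E = 0$ is the linear form $E$. Equations are linearly independent if their contents are; a collection implies an equation if that equation's content is a linear combination of the collection's contents. An equation involves $x_j$ if the coefficient of $x_j$ is nonzero. A collection is valid if it does not imply $x_a - x_b = 0$ for any $a \neq b$. A difference equality is degenerate if it is of the form $x_a - x_b = 0$ with $a \neq b$ (equivalently, the sets $\{i_1,i_4\}$ and $\{i_2,i_3\}$ are different but not disjoint), and nondegenerate otherwise. In a nondegenerate difference equality, $x_a$ and $x_b$ appear with opposite sign if it can be written as $x_a - x_b = x_{a'} - x_{b'}$ for some indices $a',b'$. For distinct indices $i,j$, a collection of linear equations $i$-certifies $j$ if it implies some nondegenerate difference equality in which $x_i$ and $x_j$ appear with opposite sign.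
   Formalization: The linear combinations behind implication, validity and linear independence of the difference equalities take rational coefficients rather than real ones. -}

module Defs where

open import Data.Nat using (ℕ; zero; suc)
open import Data.Fin using (Fin; zero; suc)
open import Data.Rational using (ℚ; 0ℚ; 1ℚ; _+_; _-_; _*_)
open import Data.Product using (Σ; ∃; _×_; _,_)
open import Relation.Nullary using (¬_)
open import Relation.Binary.PropositionalEquality using (_≡_; _≢_)
open import Relation.Nullary.Decidable using (⌊_⌋)
open import Data.Fin using (_≟_)

Σ[<_]_ : (m : ℕ) → (Fin m → ℚ) → ℚ
Σ[< zero  ] f = 0ℚ
Σ[< suc m ] f = f zero + Σ[< m ] (λ l → f (suc l))

δ : ∀ {k} → Fin k → Fin k → ℚ
δ a j with a ≟ j
... | Relation.Nullary.yes _ = 1ℚ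
... | Relation.Nullary.no  _ = 0ℚ

-- A linear form in x_1..x_k, given by its coefficient vector.
Form : ℕ → Set
Form k = Fin k → ℚ

-- A quadruple (i1,i2,i3,i4) representing x_{i1} - x_{i2} - x_{i3} + x_{i4} = 0.
record Quad (k : ℕ) : Set where
  constructor quad
  field
    i₁ i₂ i₃ i₄ : Fin k
open Quad public

content : ∀ {k} → Quad k → Form k
content (quad a b c d) j = ((δ a j - δ b j) - δ c j) + δ d j

_∈₂_ : ∀ {k} → Fin k → Fin k × Fin k → Set
x ∈₂ (a , b) = (x ≡ a) Data.Sum.⊎ (x ≡ b)
  where import Data.Sum

SameSet : ∀ {k} → Fin k × Fin k → Fin k × Fin k → Set
SameSet p q = (∀ x → x ∈₂ p → x ∈₂ q) × (∀ x → x ∈₂ q → x ∈₂ p)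

record DiffEq (k : ℕ) : Set where
  constructor diffEq
  field
    q    : Quad k
    side : ¬ SameSet (i₁ q , i₄ q) (i₂ q , i₃ q)
open DiffEq public

Nondegenerate : ∀ {k} → Quad k → Set
Nondegenerate (quad a b c d) = ∀ x → x ∈₂ (a , d) → ¬ (x ∈₂ (b , c))

-- A collection of m difference equalities, indexed by Fin m (|S| = m).
Collection : ℕ → ℕ → Set
Collection k m = Fin m → DiffEq k

Implies : ∀ {k m} → Collection k m → Form k → Set
Implies {k} {m} S e =
  Σ (Fin m → ℚ) λ c → ∀ (j : Fin k) → e j ≡ Σ[< m ] (λ l → c l * content (q (S l)) j)

LinearlyIndependent : ∀ {k m} → Collection k m → Set
LinearlyIndependent {k} {m} S =
  ∀ (c : Fin m → ℚ) → (∀ (j : Fin k) → Σ[< m ] (λ l → c l * content (q (S l)) j) ≡ 0ℚ)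
    → ∀ l → c l ≡ 0ℚ

diffForm : ∀ {k} → Fin k → Fin k → Form k
diffForm a b j = δ a j - δ b j

Valid : ∀ {k m} → Collection k m → Set
Valid {k} S = ∀ (a b : Fin k) → a ≢ b → ¬ Implies S (diffForm a b)

Involves : ∀ {k} → DiffEq k → Fin k → Set
Involves E j = content (q E) j ≢ 0ℚ

-- S i-certifies j (i ≠ j): S implies some nondegenerate difference equality
-- which can be written x_i - x_j = x_{a'} - x_{b'}, i.e. given by the quadruple (i, j, a', b').
Certifies : ∀ {k m} → Collection k m → Fin k → Fin k → Set
Certifies {k} S i j =
  i ≢ j × ∃ λ (a' : Fin k) → ∃ λ (b' : Fin k) →
    ¬ SameSet (i , b') (j , a') × Nondegenerate (quad i j a' b')
    × Implies S (content (quad i j a' b'))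

-- Induction on the number of rows of a family s of linear forms whose span contains no x_a - x_b.
-- If a row has a nonzero coefficient at x_t, eliminating x_t with that row yields a family with one
-- row fewer, whose span is the part of the old span not involving x_t: it still contains no
-- x_a - x_b, and every certificate x_i - x_a = x_x - x_y in which t does not occur survives. So it
-- suffices to find a certified t for which at most two of the given indices have all their
-- certificates mentioning t. Such a t exists by double counting, using that x_i - x_a = x_x - x_y is
-- also a certificate of x, and that x_i - x_a = x_x - x_y and x_i - x_a = x_y - x_x cannot both hold
-- (their difference is a multiple of x_x - x_y).
module Submission where

module DuplicateFreeLists where

  open import Data.Nat using (ℕ; suc; _+_; _≤_; _<_; z≤n; s≤s)
  open import Data.Nat.Properties
    using (≤-trans; <⇒≱; ≤-antisym; +-mono-≤; +-monoʳ-≤; +-cancelʳ-≤; +-cancelˡ-≡; +-suc;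
           +-commutativeSemigroup; module ≤-Reasoning)
  open import Data.Nat.ListAction using (sum)
  open import Data.List using (List; []; _∷_; length; filter; map)
  open import Data.List.Properties using (filter-notAll)
  open import Data.List.Relation.Unary.Any as Any using (here; there)
  open import Data.List.Relation.Unary.AllPairs using (_∷_)
  import Data.List.Relation.Unary.All as All
  open import Data.List.Relation.Unary.Unique.Propositional using (Unique)
  open import Data.List.Membership.Propositional using (_∈_; _∉_)
  open import Data.List.Membership.Propositional.Properties using (∈-filter⁺)
  open import Data.List.Relation.Binary.Subset.Propositional using (_⊆_)
  import Data.List.Membership.DecPropositional as DecMembership
  open import Algebra.Properties.CommutativeSemigroup +-commutativeSemigroup using (x∙yz≈y∙xz)
  open import Function using (_∘′_)
  open import Relation.Nullary using (Dec; yes; no; ¬?; contradiction)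
  open import Relation.Unary using (Decidable)
  open import Relation.Binary.Definitions using (DecidableEquality)
  open import Relation.Binary.PropositionalEquality

  private variable A : Set

  module _ (_≟_ : DecidableEquality A) where

    open DecMembership _≟_ using (_∈?_)

    private
      without : A → List A → List A
      without x = filter (λ y → ¬? (y ≟ x))

      ∈⇒length-without< : ∀ {x ys} → x ∈ ys → length (without x ys) < length ys
      ∈⇒length-without< {x} {ys} x∈ys =
        filter-notAll (λ y → ¬? (y ≟ x)) ys (Any.map (λ x≡y y≢x → y≢x (sym x≡y)) x∈ys)

      ⊆-without : ∀ {x xs ys} → x ∉ xs → xs ⊆ ys → xs ⊆ without x ys
      ⊆-without x∉xs xs⊆ys z∈xs = ∈-filter⁺ _ (xs⊆ys z∈xs) λ { refl → x∉xs z∈xs }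

    Unique-⊆⇒length≤ : ∀ {xs ys : List A} → Unique xs → xs ⊆ ys → length xs ≤ length ys
    Unique-⊆⇒length≤ {[]}     _                 _      = z≤n
    Unique-⊆⇒length≤ {x ∷ xs} {ys} (x∉xs ∷ uniq) x∷xs⊆ys = ≤-trans
      (s≤s (Unique-⊆⇒length≤ uniq (⊆-without (λ x∈xs → All.lookup x∉xs x∈xs refl) (x∷xs⊆ys ∘′ there))))
      (∈⇒length-without< (x∷xs⊆ys (here refl)))

    Unique-⊆-length≥⇒⊇ : ∀ {xs ys : List A} → Unique xs → xs ⊆ ys → length ys ≤ length xs → ys ⊆ xs
    Unique-⊆-length≥⇒⊇ {xs} {ys} uniq xs⊆ys |ys|≤|xs| {y} y∈ys with y ∈? xs
    ... | yes y∈xs = y∈xs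
    ... | no  y∉xs = contradiction (≤-trans |ys|≤|xs| (Unique-⊆⇒length≤ uniq (⊆-without y∉xs xs⊆ys)))
                                   (<⇒≱ (∈⇒length-without< y∈ys))

  module _ {P : A → Set} (P? : Decidable P) where

    length-filter+length-filter-∁ : ∀ xs →
      length (filter P? xs) + length (filter (λ x → ¬? (P? x)) xs) ≡ length xs
    length-filter+length-filter-∁ []       = refl
    length-filter+length-filter-∁ (x ∷ xs) with P? x
    ... | yes _ = cong suc (length-filter+length-filter-∁ xs)
    ... | no  _ = trans (+-suc _ _) (cong suc (length-filter+length-filter-∁ xs))

  module _ {R : A → A → Set} (R? : ∀ t a → Dec (R t a)) where

    private
      count : List A → A → ℕ
      count ts a = length (filter (λ t → R? t a) ts)

      total : List A → List A → ℕ
      total ts as = sum (map (count ts) as)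

      shuffle : ∀ c f r {s} → s ≡ f + r → c + s ≡ f + (c + r)
      shuffle c f r s≡f+r = trans (cong (c +_) s≡f+r) (x∙yz≈y∙xz c f r)

      total-∷ : ∀ t ts as → total (t ∷ ts) as ≡ length (filter (R? t) as) + total ts as
      total-∷ t ts []       = refl
      total-∷ t ts (a ∷ as) with R? t a
      ... | yes _ = cong suc (shuffle (count ts a) (length (filter (R? t) as)) (total ts as) (total-∷ t ts as))
      ... | no  _ = shuffle (count ts a) (length (filter (R? t) as)) (total ts as) (total-∷ t ts as)

      total-[] : ∀ as → total [] as ≡ 0
      total-[] []       = refl
      total-[] (_ ∷ as) = total-[] as

    sum-length-filter-comm : ∀ ts as → sum (map (λ t → length (filter (R? t) as)) ts)
                                     ≡ sum (map (λ a → length (filter (λ t → R? t a) ts)) as)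
    sum-length-filter-comm []       as = sym (total-[] as)
    sum-length-filter-comm (t ∷ ts) as =
      trans (cong (length (filter (R? t) as) +_) (sum-length-filter-comm ts as)) (sym (total-∷ t ts as))

  private
    m+n≡o+p⇒m≡o : ∀ {m n o p} → m + n ≡ o + p → o ≤ m → p ≤ n → m ≡ o
    m+n≡o+p⇒m≡o {m} {n} {o} {p} m+n≡o+p o≤m p≤n = ≤-antisym (+-cancelʳ-≤ n m o (begin
      m + n ≡⟨ m+n≡o+p ⟩
      o + p ≤⟨ +-monoʳ-≤ o p≤n ⟩
      o + n ∎)) o≤m
      where open ≤-Reasoning

  module _ (f g : A → ℕ) where

    sum-map-mono-≤ : ∀ xs → (∀ {x} → x ∈ xs → g x ≤ f x) → sum (map g xs) ≤ sum (map f xs)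
    sum-map-mono-≤ []       _   = z≤n
    sum-map-mono-≤ (x ∷ xs) g≤f = +-mono-≤ (g≤f (here refl)) (sum-map-mono-≤ xs (g≤f ∘′ there))

    sum-map-≡⇒≡ : ∀ xs → (∀ {x} → x ∈ xs → g x ≤ f x) → sum (map f xs) ≡ sum (map g xs) →
                  ∀ {x} → x ∈ xs → f x ≡ g x
    sum-map-≡⇒≡ (x ∷ xs) g≤f sums≡ (here refl)  =
      m+n≡o+p⇒m≡o sums≡ (g≤f (here refl)) (sum-map-mono-≤ xs (g≤f ∘′ there))
    sum-map-≡⇒≡ (x ∷ xs) g≤f sums≡ (there y∈xs) = sum-map-≡⇒≡ xs (g≤f ∘′ there) tails≡ y∈xs
      where
      tails≡ : sum (map f xs) ≡ sum (map g xs)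
      tails≡ = +-cancelˡ-≡ (f x) _ _
        (trans sums≡ (cong (_+ sum (map g xs)) (sym (sum-map-≡⇒≡ (x ∷ xs) g≤f sums≡ (here refl)))))

module Span where

  open import Defs
  open import Algebra.Bundles using (CommutativeRing)
  open import Data.Nat using (ℕ; zero; suc)
  open import Data.Fin using (Fin; zero; suc; punchIn)
  open import Data.Fin.Properties using (¬∀⟶∃¬)
  open import Data.Rational using (ℚ; 0ℚ; 1ℚ; _+_; _-_; _*_; -_; 1/_; ≢-nonZero)
  open import Data.Rational.Properties
    using (+-*-commutativeRing; +-0-group; *-inverseʳ; *-identityʳ; *-assoc; *-zeroʳ; neg-distribˡ-*; _≟_)
  open import Algebra.Properties.Group +-0-group using (inverseˡ-unique)
  open import Data.Rational.Solver using (module +-*-Solver)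
  open import Data.Vec.Functional using (removeAt; insertAt)
  open import Data.Vec.Functional.Properties using (insertAt-lookup; removeAt-insertAt)
  open import Data.Product using (∃; _,_)
  open import Relation.Nullary using (¬_)
  open import Function using (_∘′_)
  open import Relation.Binary.PropositionalEquality
  open import Algebra.Properties.Semiring.Sum (CommutativeRing.semiring +-*-commutativeRing)
    using (sum; sum-cong-≗; sum-remove; sum-replicate-zero; ∑-distrib-+; *-distribˡ-sum; *-distribʳ-sum)
  open +-*-Solver

  private variable k m : ℕ

  Σ≡sum : (f : Fin m → ℚ) → Σ[< m ] f ≡ sum f
  Σ≡sum {zero}  f = refl
  Σ≡sum {suc m} f = cong (f zero +_) (Σ≡sum (λ l → f (suc l)))

  combination : (Fin m → ℚ) → (Fin m → Form k) → Form k
  combination c s j = sum (λ l → c l * s l j)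

  InSpan : (Fin m → Form k) → Form k → Set
  InSpan s e = ∃ λ c → ∀ j → e j ≡ combination c s j

  DiffFree : (Fin m → Form k) → Set
  DiffFree {k = k} s = ∀ (a b : Fin k) → a ≢ b → ¬ InSpan s (diffForm a b)

  module _ {s : Fin m → Form k} where

    InSpan-resp : ∀ {e e′} → (∀ j → e j ≡ e′ j) → InSpan s e → InSpan s e′
    InSpan-resp e≗e′ (c , e≡) = c , λ j → trans (sym (e≗e′ j)) (e≡ j)

    InSpan-lincomb : ∀ {e₁ e₂} α β → InSpan s e₁ → InSpan s e₂ → InSpan s (λ j → α * e₁ j + β * e₂ j)
    InSpan-lincomb {e₁} {e₂} α β (c₁ , e₁≡) (c₂ , e₂≡) = (λ l → α * c₁ l + β * c₂ l) , λ j → begin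
      α * e₁ j + β * e₂ j
        ≡⟨ cong₂ (λ x y → α * x + β * y) (e₁≡ j) (e₂≡ j) ⟩
      α * combination c₁ s j + β * combination c₂ s j
        ≡⟨ cong₂ _+_ (*-distribˡ-sum α (λ l → c₁ l * s l j)) (*-distribˡ-sum β (λ l → c₂ l * s l j)) ⟩
      sum (λ l → α * (c₁ l * s l j)) + sum (λ l → β * (c₂ l * s l j))
        ≡⟨ ∑-distrib-+ (λ l → α * (c₁ l * s l j)) (λ l → β * (c₂ l * s l j)) ⟨
      sum (λ l → α * (c₁ l * s l j) + β * (c₂ l * s l j))
        ≡⟨ sum-cong-≗ (λ l → solve 5 (λ a b x y z → a :* (x :* z) :+ b :* (y :* z) := (a :* x :+ b :* y) :* z)
                                    refl α β (c₁ l) (c₂ l) (s l j)) ⟩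
      combination (λ l → α * c₁ l + β * c₂ l) s j ∎
      where open ≡-Reasoning

    InSpan⇒∃coefficient≢0 : ∀ {e} t → InSpan s e → e t ≢ 0ℚ → ∃ λ l → s l t ≢ 0ℚ
    InSpan⇒∃coefficient≢0 {e} t (c , e≡) et≢0 =
      ¬∀⟶∃¬ m (λ l → s l t ≡ 0ℚ) (λ l → s l t ≟ 0ℚ) all-zero⇒⊥
      where
      all-zero⇒⊥ : ¬ (∀ l → s l t ≡ 0ℚ)
      all-zero⇒⊥ zero-column = et≢0 (begin
        e t                        ≡⟨ e≡ t ⟩
        combination c s t          ≡⟨ sum-cong-≗ (λ l → trans (cong (c l *_) (zero-column l)) (*-zeroʳ (c l))) ⟩
        sum {m} (λ _ → 0ℚ)         ≡⟨ sum-replicate-zero m ⟩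
        0ℚ                         ∎)
        where open ≡-Reasoning

  module Elimination (s : Fin (suc m) → Form k) (p : Fin (suc m)) (t : Fin k) (pivot≢0 : s p t ≢ 0ℚ) where

    private instance
      pivot-nonZero = ≢-nonZero pivot≢0

    ratio : Fin m → ℚ
    ratio l = s (punchIn p l) t * 1/ s p t

    eliminated : Fin m → Form k
    eliminated l j = s (punchIn p l) j - ratio l * s p j

    private
      combination-eliminated : ∀ d j →
        combination d eliminated j ≡ combination d (removeAt s p) j - sum (λ l → d l * ratio l) * s p j
      combination-eliminated d j = begin
        sum (λ l → d l * (s (punchIn p l) j - ratio l * s p j))
          ≡⟨ sum-cong-≗ (λ l → solve 4 (λ d u r z → d :* (u :- r :* z) := d :* u :+ (d :* r) :* (:- z))
                                      refl (d l) (s (punchIn p l) j) (ratio l) (s p j)) ⟩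
        sum (λ l → d l * s (punchIn p l) j + (d l * ratio l) * - s p j)
          ≡⟨ ∑-distrib-+ (λ l → d l * s (punchIn p l) j) (λ l → (d l * ratio l) * - s p j) ⟩
        D + sum (λ l → (d l * ratio l) * - s p j)
          ≡⟨ cong (D +_) (*-distribʳ-sum (- s p j) (λ l → d l * ratio l)) ⟨
        D + sum (λ l → d l * ratio l) * - s p j
          ≡⟨ solve 3 (λ x y z → x :+ y :* (:- z) := x :- y :* z) refl D (sum (λ l → d l * ratio l)) (s p j) ⟩
        D - sum (λ l → d l * ratio l) * s p j ∎
        where
        open ≡-Reasoning
        D = combination d (removeAt s p) j

      pivot-coefficient : ∀ c → combination c s t ≡ 0ℚ → c p ≡ - sum (λ l → removeAt c p l * ratio l)
      pivot-coefficient c vanishes = begin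
        c p                       ≡⟨ *-identityʳ (c p) ⟨
        c p * 1ℚ                  ≡⟨ cong (c p *_) (*-inverseʳ (s p t)) ⟨
        c p * (s p t * 1/ s p t)  ≡⟨ *-assoc (c p) (s p t) (1/ s p t) ⟨
        c p * s p t * 1/ s p t    ≡⟨ cong (_* 1/ s p t) (inverseˡ-unique (c p * s p t) X
                                       (trans (sym (sum-remove (λ l → c l * s l t))) vanishes)) ⟩
        - X * 1/ s p t            ≡⟨ neg-distribˡ-* X (1/ s p t) ⟨
        - (X * 1/ s p t)          ≡⟨ cong -_ (*-distribʳ-sum (1/ s p t) (λ l → removeAt c p l * s (punchIn p l) t)) ⟩
        - sum (λ l → removeAt c p l * s (punchIn p l) t * 1/ s p t)
          ≡⟨ cong -_ (sum-cong-≗ λ l → *-assoc (c (punchIn p l)) (s (punchIn p l) t) (1/ s p t)) ⟩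
        - sum (λ l → removeAt c p l * ratio l) ∎
        where
        open ≡-Reasoning
        X = combination (removeAt c p) (removeAt s p) t

    InSpan-eliminated⇒InSpan : ∀ {e} → InSpan eliminated e → InSpan s e
    InSpan-eliminated⇒InSpan {e} (d , e≡) = c , λ j → begin
      e j
        ≡⟨ trans (e≡ j) (combination-eliminated d j) ⟩
      combination d (removeAt s p) j - Y * s p j
        ≡⟨ solve 3 (λ x y z → x :- y :* z := (:- y) :* z :+ x) refl (combination d (removeAt s p) j) Y (s p j) ⟩
      - Y * s p j + combination d (removeAt s p) j
        ≡⟨ cong₂ (λ x y → x * s p j + y) (insertAt-lookup d p (- Y))
                 (sum-cong-≗ λ l → cong (_* s (punchIn p l) j) (removeAt-insertAt d p (- Y) l)) ⟨
      c p * s p j + combination (removeAt c p) (removeAt s p) j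
        ≡⟨ sum-remove (λ l → c l * s l j) ⟨
      combination c s j ∎
      where
      open ≡-Reasoning
      Y = sum (λ l → d l * ratio l)
      c = insertAt d p (- Y)

    InSpan⇒InSpan-eliminated : ∀ {e} → InSpan s e → e t ≡ 0ℚ → InSpan eliminated e
    InSpan⇒InSpan-eliminated {e} (c , e≡) et≡0 = removeAt c p , λ j → begin
      e j
        ≡⟨ trans (e≡ j) (sum-remove (λ l → c l * s l j)) ⟩
      c p * s p j + D j
        ≡⟨ cong (λ x → x * s p j + D j) (pivot-coefficient c (trans (sym (e≡ t)) et≡0)) ⟩
      - Y * s p j + D j
        ≡⟨ solve 3 (λ x y z → (:- y) :* z :+ x := x :- y :* z) refl (D j) Y (s p j) ⟩
      D j - Y * s p j
        ≡⟨ combination-eliminated (removeAt c p) j ⟨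
      combination (removeAt c p) eliminated j ∎
      where
      open ≡-Reasoning
      Y = sum (λ l → removeAt c p l * ratio l)
      D = combination (removeAt c p) (removeAt s p)

    eliminated-DiffFree : DiffFree s → DiffFree eliminated
    eliminated-DiffFree free a b a≢b = free a b a≢b ∘′ InSpan-eliminated⇒InSpan

module LightIndices where

  open DuplicateFreeLists
  open import Data.Nat using (ℕ; _≤_; _≤?_; s≤s)
  open import Data.Nat.Properties using (≤-trans; ≤-reflexive; ≰⇒>)
  open import Data.Fin using (Fin; _≟_)
  open import Data.Fin.Properties using (any?)
  open import Data.List using (List; []; _∷_; length; filter)
  open import Data.List.Relation.Unary.All as All using (All; []; _∷_)
  open import Data.List.Relation.Unary.Any as Any using (here; there)
  open import Data.List.Relation.Unary.AllPairs using ([]; _∷_)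
  open import Data.List.Relation.Unary.Unique.Propositional using (Unique)
  open import Data.List.Relation.Unary.Unique.Propositional.Properties using (filter⁺)
  open import Data.List.Membership.Propositional using (_∈_; find)
  open import Data.List.Membership.Propositional.Properties using (∈-filter⁺; ∈-filter⁻)
  open import Data.List.Relation.Binary.Subset.Propositional using (_⊆_)
  open import Data.Product using (∃; ∃₂; _×_; _,_; proj₂)
  open import Data.Empty using (⊥; ⊥-elim)
  open import Function using (_∘′_)
  open import Relation.Nullary using (¬_; Dec; yes; no; ¬?; _×-dec_; contradiction)
  open import Relation.Binary.PropositionalEquality

  -- Cert a x y abstracts a certificate x_i - x_a = x_x - x_y of a: only its symmetry in a and x
  -- and its asymmetry in x and y are used.
  module LightIndex {k : ℕ} (Cert : Fin k → Fin k → Fin k → Set)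
    (Cert? : ∀ a x y → Dec (Cert a x y))
    (Cert-swap : ∀ {a x y} → Cert a x y → Cert x a y)
    (Cert-asym : ∀ {a x y} → Cert a x y → ¬ Cert a y x) where

    Certified : Fin k → Set
    Certified a = ∃₂ (Cert a)

    Avoids : Fin k → Fin k → Set
    Avoids a t = ∃₂ λ x y → Cert a x y × t ≢ a × t ≢ x × t ≢ y

    Avoids? : ∀ a t → Dec (Avoids a t)
    Avoids? a t = any? λ x → any? λ y → Cert? a x y ×-dec ¬? (t ≟ a) ×-dec ¬? (t ≟ x) ×-dec ¬? (t ≟ y)

    -- The members of L all of whose certificates mention t: they may lose their certificates when
    -- x_t is eliminated.
    killed : Fin k → List (Fin k) → List (Fin k)
    killed t = filter (λ a → ¬? (Avoids? a t))

    private
      killers : List (Fin k) → Fin k → List (Fin k)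
      killers L a = filter (λ t → ¬? (Avoids? a t)) L

      killers⊆ : ∀ L {a x y} → Cert a x y → killers L a ⊆ a ∷ x ∷ y ∷ []
      killers⊆ L {a} {x} {y} c {u} u∈ with u ≟ a | u ≟ x | u ≟ y
      ... | yes u≡a | _       | _       = here u≡a
      ... | no  _   | yes u≡x | _       = there (here u≡x)
      ... | no  _   | no  _   | yes u≡y = there (there (here u≡y))
      ... | no  u≢a | no  u≢x | no  u≢y =
        ⊥-elim (proj₂ (∈-filter⁻ (λ t → ¬? (Avoids? a t)) {xs = L} u∈) (x , y , c , u≢a , u≢x , u≢y))

      Cert⇒≢ : ∀ {a x y} → Cert a x y → x ≢ y
      Cert⇒≢ c refl = Cert-asym c c

      two-certificates⇒Avoids : ∀ {a p q w} → Cert a p q → Cert a q w → p ≢ a → p ≢ q → Avoids a p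
      two-certificates⇒Avoids {p = p} {w = w} c c′ p≢a p≢q with p ≟ w
      ... | yes refl = contradiction c (Cert-asym c′)
      ... | no  p≢w  = _ , _ , c′ , p≢a , p≢q , p≢w

    -- If every index of L killed at least three indices of L, double counting would force every
    -- a ∈ L certified by (x , y) to be killed by exactly a, x and y, all three lying in L.
    module _ (L : List (Fin k)) (uniq : Unique L) (certified : All Certified L)
             (heavy : ∀ {t} → t ∈ L → 3 ≤ length (killed t L)) where

      private
        killers≤3 : ∀ {a} → a ∈ L → length (killers L a) ≤ 3
        killers≤3 a∈L with All.lookup certified a∈L
        ... | _ , _ , c = Unique-⊆⇒length≤ _≟_ (filter⁺ _ uniq) (killers⊆ L c)

        killed≡killers : ∀ {t} → t ∈ L → length (killed t L) ≡ length (killers L t)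
        killed≡killers = sum-map-≡⇒≡ (λ t → length (killed t L)) (λ a → length (killers L a)) L
          (λ t∈L → ≤-trans (killers≤3 t∈L) (heavy t∈L))
          (sum-length-filter-comm (λ t a → ¬? (Avoids? a t)) L L)

        killed≤3 : ∀ {t} → t ∈ L → length (killed t L) ≤ 3
        killed≤3 t∈L = ≤-trans (≤-reflexive (killed≡killers t∈L)) (killers≤3 t∈L)

        3≤killers : ∀ {a} → a ∈ L → 3 ≤ length (killers L a)
        3≤killers a∈L = ≤-trans (heavy a∈L) (≤-reflexive (killed≡killers a∈L))

        3≰2 : ¬ 3 ≤ 2
        3≰2 (s≤s (s≤s ()))

        killer⇒⊭ : ∀ {a u} → u ∈ killers L a → u ∈ L × ¬ Avoids a u
        killer⇒⊭ {a} = ∈-filter⁻ (λ t → ¬? (Avoids? a t)) {xs = L}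

        Cert⇒killers : ∀ {a x y} → a ∈ L → Cert a x y →
                       (x ∈ L × ¬ Avoids a x) × (y ∈ L × ¬ Avoids a y) × a ≢ x
        Cert⇒killers {a} {x} {y} a∈L c =
            killer⇒⊭ (⊇killers (there (here refl)))
          , killer⇒⊭ (⊇killers (there (there (here refl))))
          , λ { refl → 3≰2 (≤-trans (3≤killers a∈L)
                                     (Unique-⊆⇒length≤ _≟_ (filter⁺ _ uniq) (merge ∘′ killers⊆ L c))) }
          where
          ⊇killers : a ∷ x ∷ y ∷ [] ⊆ killers L a
          ⊇killers = Unique-⊆-length≥⇒⊇ _≟_ (filter⁺ _ uniq) (killers⊆ L c) (3≤killers a∈L)
          merge : ∀ {u p q} → u ∈ p ∷ p ∷ q ∷ [] → u ∈ p ∷ q ∷ []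
          merge (here e)          = here e
          merge (there (here e))  = here e
          merge (there (there m)) = there m

        4≰3 : ¬ 4 ≤ 3
        4≰3 (s≤s le) = 3≰2 le

      -- With t₀ certified by (x , y) and y by (u , w), the indices t₀, x, y, u are all killed by y,
      -- so u is t₀ or x; either way that index gets a second certificate avoiding the other one.
      heavy⇒⊥ : ∀ {t₀} → t₀ ∈ L → ⊥
      heavy⇒⊥ {t₀} t₀∈L with All.lookup certified t₀∈L
      ... | x , y , c with Cert⇒killers t₀∈L c
      ... | (x∈L , t₀⊭x) , (y∈L , t₀⊭y) , t₀≢x with Cert⇒killers x∈L (Cert-swap c) | All.lookup certified y∈L
      ... | (_ , x⊭t₀) , (_ , x⊭y) , _ | u , w , c′ with Cert⇒killers y∈L c′
      ... | (u∈L , _) , _ , y≢u with Cert⇒killers u∈L (Cert-swap c′) | u ≟ t₀ | u ≟ x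
      ... | _ | yes refl | _ = t₀⊭x (two-certificates⇒Avoids c (Cert-swap c′) (≢-sym t₀≢x) (Cert⇒≢ c))
      ... | _ | _ | yes refl =
        x⊭t₀ (two-certificates⇒Avoids (Cert-swap c) (Cert-swap c′) t₀≢x (Cert⇒≢ (Cert-swap c)))
      ... | (_ , u⊭y) , _ | no u≢t₀ | no u≢x =
        4≰3 (≤-trans (Unique-⊆⇒length≤ _≟_ distinct ⊆killed) (killed≤3 y∈L))
        where
        distinct : Unique (t₀ ∷ x ∷ y ∷ u ∷ [])
        distinct = (t₀≢x ∷ Cert⇒≢ (Cert-swap c) ∷ ≢-sym u≢t₀ ∷ [])
                 ∷ (Cert⇒≢ c ∷ ≢-sym u≢x ∷ []) ∷ (y≢u ∷ []) ∷ [] ∷ []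
        ⊆killed : t₀ ∷ x ∷ y ∷ u ∷ [] ⊆ killed y L
        ⊆killed (here refl)                         = ∈-filter⁺ _ t₀∈L t₀⊭y
        ⊆killed (there (here refl))                 = ∈-filter⁺ _ x∈L x⊭y
        ⊆killed (there (there (here refl)))         = ∈-filter⁺ _ y∈L λ (_ , _ , _ , y≢y , _) → y≢y refl
        ⊆killed (there (there (there (here refl)))) = ∈-filter⁺ _ u∈L u⊭y

    light-index : ∀ L → Unique L → All Certified L → ∀ {t₀} → t₀ ∈ L →
                  ∃ λ t → t ∈ L × length (killed t L) ≤ 2
    light-index L uniq certified t₀∈L with Any.any? (λ t → length (killed t L) ≤? 2) L
    ... | yes light = find light
    ... | no  ¬light =
      ⊥-elim (heavy⇒⊥ L uniq certified (λ t∈L → ≰⇒> λ le → ¬light (Any.map (λ { refl → le }) t∈L)) t₀∈L)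

module Certificates where

  open import Defs
  open Span
  open DuplicateFreeLists
  open LightIndices
  open import Data.Nat using (ℕ; zero; suc; _≤_; _≤?_; z≤n) renaming (_*_ to _*ℕ_; _+_ to _+ℕ_)
  open import Data.Nat.Properties using (+-mono-≤; *-suc; +-comm; module ≤-Reasoning)
  open import Data.Fin using (Fin; zero; suc; _≟_)
  open import Data.Rational using (0ℚ; 1ℚ; _+_; _*_; -_; ½)
  open import Data.Rational.Solver using (module +-*-Solver)
  open import Data.List using ([]; _∷_; length; filter)
  open import Data.Sum using (inj₁; inj₂)
  open import Data.List.Relation.Unary.All as All using (All)
  open import Data.List.Relation.Unary.Any using (here)
  open import Data.List.Relation.Unary.Unique.Propositional using (Unique)
  open import Data.List.Relation.Unary.Unique.Propositional.Properties using (filter⁺)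
  open import Data.List.Membership.Propositional.Properties using (∈-filter⁻)
  open import Data.Product using (∃; ∃₂; _×_; _,_; proj₂)
  open import Data.Empty using (⊥-elim)
  open import Relation.Nullary using (¬_; Dec; yes; no)
  open import Relation.Nullary.Decidable using (decidable-stable; ¬¬-excluded-middle)
  open import Relation.Binary.PropositionalEquality
  open +-*-Solver

  private variable k m : ℕ

  δ-refl : (a : Fin k) → δ a a ≡ 1ℚ
  δ-refl a with a ≟ a
  ... | yes _   = refl
  ... | no  a≢a = ⊥-elim (a≢a refl)

  δ-≢ : {a j : Fin k} → a ≢ j → δ a j ≡ 0ℚ
  δ-≢ {a = a} {j} a≢j with a ≟ j
  ... | yes a≡j = ⊥-elim (a≢j a≡j)
  ... | no  _   = refl

  content-swap : ∀ (i a x y j : Fin k) → content (quad i a x y) j ≡ content (quad i x a y) j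
  content-swap i a x y j =
    solve 4 (λ dᵢ dₐ dₓ d_y → ((dᵢ :- dₐ) :- dₓ) :+ d_y := ((dᵢ :- dₓ) :- dₐ) :+ d_y)
            refl (δ i j) (δ a j) (δ x j) (δ y j)

  content-half-difference : ∀ (i a x y j : Fin k) →
    ½ * content (quad i a x y) j + - ½ * content (quad i a y x) j ≡ diffForm y x j
  content-half-difference i a x y j =
    solve 4 (λ dᵢ dₐ dₓ d_y → con ½ :* (((dᵢ :- dₐ) :- dₓ) :+ d_y) :+ con (- ½) :* (((dᵢ :- dₐ) :- d_y) :+ dₓ)
                               := d_y :- dₓ)
            refl (δ i j) (δ a j) (δ x j) (δ y j)

  content-at-certified≢0 : ∀ {i a x y : Fin k} → i ≢ a → y ≢ a → content (quad i a x y) a ≢ 0ℚ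
  content-at-certified≢0 {a = a} {x} i≢a y≢a with x ≟ a
  ... | yes refl rewrite δ-≢ i≢a | δ-refl a | δ-≢ y≢a = λ ()
  ... | no  _    rewrite δ-≢ i≢a | δ-refl a | δ-≢ y≢a = λ ()

  content-vanishes : ∀ {i a x y t : Fin k} → i ≢ t → a ≢ t → x ≢ t → y ≢ t →
                     content (quad i a x y) t ≡ 0ℚ
  content-vanishes i≢t a≢t x≢t y≢t rewrite δ-≢ i≢t | δ-≢ a≢t | δ-≢ x≢t | δ-≢ y≢t = refl

  ¬¬-Π-Fin : ∀ n {P : Fin n → Set} → (∀ x → ¬ ¬ P x) → ¬ ¬ (∀ x → P x)
  ¬¬-Π-Fin zero    _     ¬∀P = ¬∀P λ ()
  ¬¬-Π-Fin (suc n) ¬¬P ¬∀P =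
    ¬¬P zero λ P₀ → ¬¬-Π-Fin n (λ x → ¬¬P (suc x)) λ P₊ → ¬∀P λ { zero → P₀ ; (suc x) → P₊ x }

  -- The span of s contains the nondegenerate difference equality x_i - x_a = x_x - x_y.
  Certificate : Fin k → (Fin m → Form k) → Fin k → Fin k → Fin k → Set
  Certificate i s a x y = i ≢ a × i ≢ x × y ≢ a × y ≢ x × InSpan s (content (quad i a x y))

  Certified : Fin k → (Fin m → Form k) → Fin k → Set
  Certified i s a = ∃₂ (Certificate i s a)

  module _ {i : Fin k} {s : Fin m → Form k} where

    Certificate-swap : ∀ {a x y} → Certificate i s a x y → Certificate i s x a y
    Certificate-swap {a} {x} {y} (i≢a , i≢x , y≢a , y≢x , in-span) =
      i≢x , i≢a , y≢x , y≢a , InSpan-resp (content-swap i a x y) in-span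

    Certificate-asym : DiffFree s → ∀ {a x y} → Certificate i s a x y → ¬ Certificate i s a y x
    Certificate-asym free {a} {x} {y} (_ , _ , _ , y≢x , in-span) (_ , _ , _ , _ , in-span′) =
      free y x y≢x (InSpan-resp (content-half-difference i a x y) (InSpan-lincomb ½ (- ½) in-span in-span′))

    ¬¬-Certificate-decidable : ¬ ¬ (∀ a x y → Dec (Certificate i s a x y))
    ¬¬-Certificate-decidable =
      ¬¬-Π-Fin k λ a → ¬¬-Π-Fin k λ x → ¬¬-Π-Fin k λ y → ¬¬-excluded-middle

    Certified⇒∃coefficient≢0 : ∀ {a} → Certified i s a → ∃ λ l → s l a ≢ 0ℚ
    Certified⇒∃coefficient≢0 {a} (x , _ , i≢a , _ , y≢a , _ , in-span) =
      InSpan⇒∃coefficient≢0 a in-span (content-at-certified≢0 {x = x} i≢a y≢a)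

  Certificate-transfer : ∀ {m′} {i t : Fin k} {s : Fin m → Form k} {s′ : Fin m′ → Form k} →
    (∀ {e} → InSpan s e → e t ≡ 0ℚ → InSpan s′ e) → i ≢ t →
    ∀ {a x y} → Certificate i s a x y → t ≢ a → t ≢ x → t ≢ y → Certificate i s′ a x y
  Certificate-transfer transfer i≢t (i≢a , i≢x , y≢a , y≢x , in-span) t≢a t≢x t≢y =
    i≢a , i≢x , y≢a , y≢x , transfer in-span (content-vanishes i≢t (≢-sym t≢a) (≢-sym t≢x) (≢-sym t≢y))

  module _ (i : Fin k) where

    -- Certificates are not decidable constructively, but the bound is a decidable statement, so its
    -- proof may assume that they are.
    mutual
      certified≤2*rows : ∀ {m} (s : Fin m → Form k) → DiffFree s →
                         ∀ L → Unique L → All (Certified i s) L → length L ≤ 2 *ℕ m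
      certified≤2*rows     s free []          _    _         = z≤n
      certified≤2*rows {m} s free L@(_ ∷ _) uniq certified =
        decidable-stable (length L ≤? 2 *ℕ m) λ ¬bound →
          ¬¬-Certificate-decidable λ Certificate? →
            ¬bound (certified≤2*rows-decidable s free uniq certified Certificate?)

      certified≤2*rows-decidable : ∀ {m} (s : Fin m → Form k) → DiffFree s → ∀ {t₀ L′} (let L = t₀ ∷ L′) →
                                   Unique L → All (Certified i s) L → (∀ a x y → Dec (Certificate i s a x y)) →
                                   length L ≤ 2 *ℕ m
      certified≤2*rows-decidable {zero} s free uniq certified _
        with Certified⇒∃coefficient≢0 {s = s} (All.lookup certified (here refl))
      ... | () , _
      certified≤2*rows-decidable {suc m} s free {t₀} {L′} uniq certified Certificate? =
        let open LightIndex (Certificate i s) Certificate? (Certificate-swap {s = s}) (Certificate-asym {s = s} free)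
                   using (light-index; Avoids?; killed)
            L = t₀ ∷ L′
            t , t∈L , light = light-index L uniq certified (here refl)
            _ , _ , i≢t , _ = All.lookup certified t∈L
            p , pivot≢0 = Certified⇒∃coefficient≢0 {s = s} (All.lookup certified t∈L)
            open Elimination s p t pivot≢0
            survivors = filter (λ a → Avoids? a t) L
            survivors-certified : All (Certified i eliminated) survivors
            survivors-certified = All.tabulate λ a∈survivors →
              let x , y , c , t≢a , t≢x , t≢y = proj₂ (∈-filter⁻ (λ a → Avoids? a t) {xs = L} a∈survivors)
              in x , y , Certificate-transfer {s = s} InSpan⇒InSpan-eliminated i≢t c t≢a t≢x t≢y
            survivors≤ = certified≤2*rows eliminated (eliminated-DiffFree free) survivors
                                          (filter⁺ (λ a → Avoids? a t) uniq) survivors-certified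
        in begin
          length L                                ≡⟨ length-filter+length-filter-∁ (λ a → Avoids? a t) L ⟨
          length survivors +ℕ length (killed t L) ≤⟨ +-mono-≤ survivors≤ light ⟩
          2 *ℕ m +ℕ 2                             ≡⟨ +-comm (2 *ℕ m) 2 ⟩
          2 +ℕ 2 *ℕ m                             ≡⟨ *-suc 2 m ⟨
          2 *ℕ suc m                              ∎
        where open ≤-Reasoning

  contents : Collection k m → Fin m → Form k
  contents S l = content (q (S l))

  module _ {S : Collection k m} where

    Implies⇒InSpan : ∀ {e} → Implies S e → InSpan (contents S) e
    Implies⇒InSpan (c , e≡) = c , λ j → trans (e≡ j) (Σ≡sum (λ l → c l * contents S l j))

    Valid⇒DiffFree : Valid S → DiffFree (contents S)
    Valid⇒DiffFree valid a b a≢b (c , e≡) =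
      valid a b a≢b (c , λ j → trans (e≡ j) (sym (Σ≡sum (λ l → c l * contents S l j))))

    Certifies⇒Certified : ∀ {i j} → Certifies S i j → Certified i (contents S) j
    Certifies⇒Certified (i≢j , a′ , b′ , _ , nondegenerate , implies) =
      a′ , b′ , i≢j ,
      (λ i≡a′ → nondegenerate _ (inj₁ refl) (inj₂ i≡a′)) ,
      (λ b′≡j → nondegenerate _ (inj₂ refl) (inj₁ b′≡j)) ,
      (λ b′≡a′ → nondegenerate _ (inj₂ refl) (inj₂ b′≡a′)) ,
      Implies⇒InSpan implies

open import Defs
open import Data.Nat using (ℕ; _≤_; _*_)
open import Data.Fin using (Fin)
open import Function.Definitions using (Injective)
open import Relation.Binary.PropositionalEquality using (_≡_; subst)
open import Data.List using (tabulate)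
open import Data.List.Properties using (length-tabulate)
import Data.List.Relation.Unary.All.Properties as All
import Data.List.Relation.Unary.Unique.Propositional.Properties as Unique
open Certificates using (contents; certified≤2*rows; Valid⇒DiffFree; Certifies⇒Certified)

lemma2p8 : ∀ (k m : ℕ) (i : Fin k) (S : Collection k m) →
    Valid S → LinearlyIndependent S → (∀ l → Involves (S l) i) →
    ∀ (n : ℕ) (f : Fin n → Fin k) → Injective _≡_ _≡_ f →
    (∀ t → Certifies S i (f t)) → n ≤ 2 * m
lemma2p8 k m i S valid _ _ n f f-injective certifies =
  subst (_≤ 2 * m) (length-tabulate f)
    (certified≤2*rows i (contents S) (Valid⇒DiffFree {S = S} valid) (tabulate f) (Unique.tabulate⁺ f-injective)
                      (All.tabulate⁺ λ t → Certifies⇒Certified {S = S} (certifies t)))
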